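{- Let $T\in\mathcal{T}^*_3$ with root $v$, having $n$ vertices of which $k$ are not leaves. Then $\lambda(T,v)\ge\frac{n+1}{2}+\frac{k-1}{10}$.
   Context: $\mathcal{T}^*_3$ is the set of finite rooted trees in which the root has degree at least $2$ and every other vertex of degree at least $2$ has degree at least $3$, together with the single-vertex rooted tree. Leaves are the non-root vertices of degree $1$ (the root is not counted as a leaf). A subtree of $T$ is a nonempty subset of $V(T)$ inducing a connected subgraph, and $\lambda(T,v)$ is the average number of vertices over all subtrees of $T$ containing $v$. -}

module Defs where

open import Data.Nat using (ℕ; zero; suc; _+_; _∸_; _≤_)
open import Data.List using (List; []; _∷_; [_]; map; _++_; concatMap; length)
open import Data.Nat.ListAction using (sum)
open import Data.Integer using (ℤ; +_)
open import Data.Rational using (ℚ; _/_; 0ℚ)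
open import Data.Product using (_×_)
open import Data.Sum using (_⊎_)
open import Relation.Binary.PropositionalEquality using (_≡_)

data Tree : Set where
  node : List Tree → Tree

-- Subtrees of a rooted tree that contain the root: a connected vertex set
-- containing the root consists of the root together with, for each child c,
-- either nothing or a connected vertex set of the subtree at c containing c.
mutual
  data Sub : Tree → Set where
    node : ∀ {ts} → Subs ts → Sub (node ts)

  data Subs : List Tree → Set where
    []   : Subs []
    skip : ∀ {t ts} → Subs ts → Subs (t ∷ ts)
    take : ∀ {t ts} → Sub t → Subs ts → Subs (t ∷ ts)

mutual
  subSize : ∀ {t} → Sub t → ℕ
  subSize (node ss) = suc (subsSize ss)

  subsSize : ∀ {ts} → Subs ts → ℕ
  subsSize []         = 0
  subsSize (skip ss)  = subsSize ss
  subsSize (take s ss) = subSize s + subsSize ss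

-- enumeration of all subtrees containing the root (each exactly once)
mutual
  allSub : (t : Tree) → List (Sub t)
  allSub (node ts) = map node (allSubs ts)

  allSubs : (ts : List Tree) → List (Subs ts)
  allSubs []       = [ [] ]
  allSubs (t ∷ ts) =
    map skip (allSubs ts) ++ concatMap (λ s → map (take s) (allSubs ts)) (allSub t)

-- average of a list of naturals (0 for the empty list)
average : List ℕ → ℚ
average []       = 0ℚ
average (x ∷ xs) = (+ sum (x ∷ xs)) / suc (length xs)

λroot : Tree → ℚ
λroot t = average (map subSize (allSub t))

mutual
  order : Tree → ℕ
  order (node ts) = suc (orderL ts)

  orderL : List Tree → ℕ
  orderL []       = 0
  orderL (t ∷ ts) = order t + orderL ts

-- leaves in the subtree at a NON-ROOT vertex t:
-- vertices of degree 1, i.e. childless non-root vertices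
mutual
  leavesNR : Tree → ℕ
  leavesNR (node [])         = 1
  leavesNR (node (t ∷ ts))   = leavesL (t ∷ ts)

  leavesL : List Tree → ℕ
  leavesL []       = 0
  leavesL (t ∷ ts) = leavesNR t + leavesL ts

-- leaves of a rooted tree (root never counted)
leaves : Tree → ℕ
leaves (node ts) = leavesL ts

nonLeaves : Tree → ℕ
nonLeaves t = order t ∸ leaves t

-- a non-root vertex with children ts has degree length ts + 1;
-- it must satisfy: degree ≥ 2 implies degree ≥ 3, recursively below.
mutual
  data GoodNR : Tree → Set where
    good : ∀ {ts} → (2 ≤ suc (length ts) → 3 ≤ suc (length ts)) → GoodL ts → GoodNR (node ts)

  data GoodL : List Tree → Set where
    []  : GoodL []
    _∷_ : ∀ {t ts} → GoodNR t → GoodL ts → GoodL (t ∷ ts)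

data InT3 : Tree → Set where
  single : InT3 (node [])
  rooted : ∀ {ts} → 2 ≤ length ts → GoodL ts → InT3 (node ts)

module Submission where

-- For a non-root vertex with subtree t there are #Sub t + 1 choices of how a
-- subtree through the root meets t: not at all, or in a subtree through the
-- root of t.  These choices are independent across the root's children, so
-- the number of subtrees through the root is a product and their total size
-- is computed by a Leibniz rule.  By induction, the mean size over the
-- #Sub t + 1 choices is at least (5 |t| + k(t)) / 10, where k counts the
-- non-leaves: for a leaf this is an equality, and at a vertex with at least two
-- children the step reduces to 5 |t| + k(t) ≤ 4 #Sub t, which holds because a
-- sum of numbers ≥ 2 is at most their product.  The mean over subtrees through
-- the root is 1 plus the sum of these means over its children.

open import Defs
open import Data.Nat using (ℕ; _+_)
open import Data.Integer using (+_; _-_)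
open import Data.Rational using (_/_; _≤_; toℚᵘ) renaming (_+_ to _+ℚ_)

open import Data.Nat as ℕ using (suc; _*_; _∸_; s≤s; z≤n; NonZero)
import Data.Nat.Properties as ℕ
open import Data.Nat.Tactic.RingSolver using (solve-∀)
open import Data.Nat.ListAction using (sum; product)
open import Data.Nat.ListAction.Properties using (sum-++)
open import Data.List using (List; []; _∷_; map; _++_; concatMap; length)
open import Data.List.Properties using (length-map; length-++; map-++; map-∘; map-cong)
open import Function using (_∘_)
open import Relation.Binary.PropositionalEquality
import Data.Integer as ℤ
import Data.Integer.Properties as ℤ
open import Data.Integer.Tactic.RingSolver using () renaming (solve-∀ to ℤ-solve-∀)
import Data.Rational.Properties as ℚ
import Data.Rational.Unnormalised as ℚᵘ
import Data.Rational.Unnormalised.Properties as ℚᵘ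

sum-map-+ˡ : ∀ {B : Set} c (g : B → ℕ) ys →
  sum (map (λ y → c + g y) ys) ≡ c * length ys + sum (map g ys)
sum-map-+ˡ c g []       = sym (trans (ℕ.+-identityʳ (c * 0)) (ℕ.*-zeroʳ c))
sum-map-+ˡ c g (y ∷ ys) = begin
  c + g y + sum (map (λ y → c + g y) ys)       ≡⟨ cong (λ s → c + g y + s) (sum-map-+ˡ c g ys) ⟩
  c + g y + (c * length ys + sum (map g ys))   ≡⟨ regroup c (g y) (length ys) (sum (map g ys)) ⟩
  c * suc (length ys) + (g y + sum (map g ys)) ∎
  where
  open ≡-Reasoning
  regroup : ∀ c a l s → c + a + (c * l + s) ≡ c * suc l + (a + s)
  regroup = solve-∀

module _ {A B C : Set} (pair : A → B → C) where

  length-concatMap-map : ∀ xs ys →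
    length (concatMap (λ x → map (pair x) ys) xs) ≡ length xs * length ys
  length-concatMap-map []       ys = refl
  length-concatMap-map (x ∷ xs) ys = begin
    length (map (pair x) ys ++ concatMap (λ x → map (pair x) ys) xs)
      ≡⟨ length-++ (map (pair x) ys) ⟩
    length (map (pair x) ys) + length (concatMap (λ x → map (pair x) ys) xs)
      ≡⟨ cong₂ _+_ (length-map (pair x) ys) (length-concatMap-map xs ys) ⟩
    length ys + length xs * length ys ∎
    where open ≡-Reasoning

  sum-concatMap-map : (f : A → ℕ) (g : B → ℕ) (h : C → ℕ) →
    (∀ x y → h (pair x y) ≡ f x + g y) → ∀ xs ys →
    sum (map h (concatMap (λ x → map (pair x) ys) xs))
      ≡ sum (map f xs) * length ys + length xs * sum (map g ys)
  sum-concatMap-map f g h h-pair []       ys = refl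
  sum-concatMap-map f g h h-pair (x ∷ xs) ys = begin
    sum (map h (map (pair x) ys ++ rest))
      ≡⟨ cong sum (map-++ h (map (pair x) ys) rest) ⟩
    sum (map h (map (pair x) ys) ++ map h rest)
      ≡⟨ sum-++ (map h (map (pair x) ys)) (map h rest) ⟩
    sum (map h (map (pair x) ys)) + sum (map h rest)
      ≡⟨ cong₂ _+_ row (sum-concatMap-map f g h h-pair xs ys) ⟩
    (f x * length ys + sum (map g ys)) + (sum (map f xs) * length ys + length xs * sum (map g ys))
      ≡⟨ regroup (f x) (length ys) (sum (map g ys)) (sum (map f xs)) (length xs) ⟩
    (f x + sum (map f xs)) * length ys + suc (length xs) * sum (map g ys) ∎
    where
    open ≡-Reasoning
    rest : List C
    rest = concatMap (λ x → map (pair x) ys) xs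
    row : sum (map h (map (pair x) ys)) ≡ f x * length ys + sum (map g ys)
    row = trans (cong sum (trans (sym (map-∘ ys)) (map-cong (h-pair x) ys)))
                (sum-map-+ˡ (f x) g ys)
    regroup : ∀ a l g s n → (a * l + g) + (s * l + n * g) ≡ (a + s) * l + suc n * g
    regroup = solve-∀

m+n≤m*n : ∀ {m n} → 2 ℕ.≤ m → 2 ℕ.≤ n → m + n ℕ.≤ m * n
m+n≤m*n {suc (suc a)} {suc (suc b)} (s≤s (s≤s z≤n)) (s≤s (s≤s z≤n)) = begin
  (2 + a) + (2 + b)                    ≤⟨ ℕ.m≤m+n _ (a + b + a * b) ⟩
  (2 + a) + (2 + b) + (a + b + a * b)  ≡⟨ expand a b ⟩
  (2 + a) * (2 + b)                    ∎
  where
  open ℕ.≤-Reasoning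
  expand : ∀ a b → (2 + a) + (2 + b) + (a + b + a * b) ≡ (2 + a) * (2 + b)
  expand = solve-∀

sum≤product : ∀ {A : Set} (f : A → ℕ) → (∀ x → 2 ℕ.≤ f x) →
  ∀ xs → sum (map f xs) ℕ.≤ product (map f xs)
sum≤product f 2≤f []           = z≤n
sum≤product f 2≤f (x ∷ [])     = ℕ.≤-reflexive (trans (ℕ.+-identityʳ (f x)) (sym (ℕ.*-identityʳ (f x))))
sum≤product f 2≤f (x ∷ y ∷ ys) = extend (sum≤product f 2≤f (y ∷ ys))
  where
  open ℕ.≤-Reasoning
  P : ℕ
  P = product (map f (y ∷ ys))
  extend : sum (map f (y ∷ ys)) ℕ.≤ P → f x + sum (map f (y ∷ ys)) ℕ.≤ f x * P
  extend ih = begin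
    f x + sum (map f (y ∷ ys))  ≤⟨ ℕ.+-monoʳ-≤ (f x) ih ⟩
    f x + P                     ≤⟨ m+n≤m*n (2≤f x) 2≤P ⟩
    f x * P                     ∎
    where
    2≤P : 2 ℕ.≤ P
    2≤P = ℕ.≤-trans (2≤f y) (ℕ.≤-trans (ℕ.m≤m+n (f y) (sum (map f ys))) ih)

average≡sum/length : ∀ xs {n} .{{_ : NonZero n}} → length xs ≡ n → average xs ≡ (+ sum xs) / n
average≡sum/length []       {{()}} refl
average≡sum/length (x ∷ xs) refl = refl

/-≤-cross : ∀ a b c d .{{_ : NonZero b}} .{{_ : NonZero d}} →
  a * d ℕ.≤ c * b → (+ a) / b ≤ (+ c) / d
/-≤-cross a (suc b) c (suc d) ad≤cb = ℚ.toℚᵘ-cancel-≤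
  (ℚᵘ.≤-respˡ-≃ (ℚᵘ.≃-sym (ℚ.toℚᵘ-fromℚᵘ (ℚᵘ.mkℚᵘ (+ a) b)))
    (ℚᵘ.≤-respʳ-≃ (ℚᵘ.≃-sym (ℚ.toℚᵘ-fromℚᵘ (ℚᵘ.mkℚᵘ (+ c) d)))
      (ℚᵘ.*≤* (subst₂ ℤ._≤_ (ℤ.pos-* a (suc d)) (ℤ.pos-* c (suc b)) (ℤ.+≤+ ad≤cb)))))

half+tenth : ∀ a b → (+ a) / 2 +ℚ (+ b) / 10 ≡ (+ (5 * a + b)) / 10
half+tenth a b = ℚ.toℚᵘ-injective (begin
  toℚᵘ ((+ a) / 2 +ℚ (+ b) / 10)
    ≈⟨ ℚ.toℚᵘ-homo-+ ((+ a) / 2) ((+ b) / 10) ⟩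
  toℚᵘ ((+ a) / 2) ℚᵘ.+ toℚᵘ ((+ b) / 10)
    ≈⟨ ℚᵘ.+-cong (ℚ.toℚᵘ-fromℚᵘ (ℚᵘ.mkℚᵘ (+ a) 1)) (ℚ.toℚᵘ-fromℚᵘ (ℚᵘ.mkℚᵘ (+ b) 9)) ⟩
  ℚᵘ.mkℚᵘ (+ a) 1 ℚᵘ.+ ℚᵘ.mkℚᵘ (+ b) 9
    ≈⟨ ℚᵘ.*≡* cross ⟩
  ℚᵘ.mkℚᵘ (+ (5 * a + b)) 9
    ≈⟨ ℚᵘ.≃-sym (ℚ.toℚᵘ-fromℚᵘ (ℚᵘ.mkℚᵘ (+ (5 * a + b)) 9)) ⟩
  toℚᵘ ((+ (5 * a + b)) / 10) ∎)
  where
  open ℚᵘ.≃-Reasoning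
  identity : ∀ x y → (x ℤ.* + 10 ℤ.+ y ℤ.* + 2) ℤ.* + 10 ≡ (+ 5 ℤ.* x ℤ.+ y) ℤ.* + 20
  identity = ℤ-solve-∀
  cross : ((+ a) ℤ.* + 10 ℤ.+ (+ b) ℤ.* + 2) ℤ.* + 10 ≡ + (5 * a + b) ℤ.* + 20
  cross = trans (identity (+ a) (+ b))
    (cong (ℤ._* + 20) (sym (trans (ℤ.pos-+ (5 * a) b) (cong (ℤ._+ + b) (ℤ.pos-* 5 a)))))

mutual
  #Sub : Tree → ℕ
  #Sub (node ts) = #Subs ts

  #Subs : List Tree → ℕ
  #Subs []       = 1
  #Subs (t ∷ ts) = suc (#Sub t) * #Subs ts

mutual
  totalSize : Tree → ℕ
  totalSize (node ts) = #Subs ts + totalSizes ts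

  totalSizes : List Tree → ℕ
  totalSizes []       = 0
  totalSizes (t ∷ ts) = totalSizes ts + (totalSize t * #Subs ts + #Sub t * totalSizes ts)

mutual
  length-allSub : ∀ t → length (allSub t) ≡ #Sub t
  length-allSub (node ts) = trans (length-map node (allSubs ts)) (length-allSubs ts)

  length-allSubs : ∀ ts → length (allSubs ts) ≡ #Subs ts
  length-allSubs []       = refl
  length-allSubs (t ∷ ts) = begin
    length (map skip (allSubs ts) ++ concatMap (λ s → map (take s) (allSubs ts)) (allSub t))
      ≡⟨ length-++ (map skip (allSubs ts)) ⟩
    length (map skip (allSubs ts)) + length (concatMap (λ s → map (take s) (allSubs ts)) (allSub t))
      ≡⟨ cong₂ _+_ (length-map skip (allSubs ts)) (length-concatMap-map take (allSub t) (allSubs ts)) ⟩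
    length (allSubs ts) + length (allSub t) * length (allSubs ts)
      ≡⟨ cong₂ (λ m n → m + n * m) (length-allSubs ts) (length-allSub t) ⟩
    #Subs ts + #Sub t * #Subs ts ∎
    where open ≡-Reasoning

mutual
  sum-sizes-allSub : ∀ t → sum (map subSize (allSub t)) ≡ totalSize t
  sum-sizes-allSub (node ts) = begin
    sum (map subSize (map node (allSubs ts)))
      ≡⟨ cong sum (sym (map-∘ (allSubs ts))) ⟩
    sum (map (λ ss → 1 + subsSize ss) (allSubs ts))
      ≡⟨ sum-map-+ˡ 1 subsSize (allSubs ts) ⟩
    1 * length (allSubs ts) + sum (map subsSize (allSubs ts))
      ≡⟨ cong₂ _+_ (trans (ℕ.*-identityˡ _) (length-allSubs ts)) (sum-sizes-allSubs ts) ⟩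
    #Subs ts + totalSizes ts ∎
    where open ≡-Reasoning

  sum-sizes-allSubs : ∀ ts → sum (map subsSize (allSubs ts)) ≡ totalSizes ts
  sum-sizes-allSubs []       = refl
  sum-sizes-allSubs (t ∷ ts) = begin
    sum (map subsSize (map skip (allSubs ts) ++ takes))
      ≡⟨ cong sum (map-++ subsSize (map skip (allSubs ts)) takes) ⟩
    sum (map subsSize (map skip (allSubs ts)) ++ map subsSize takes)
      ≡⟨ sum-++ (map subsSize (map skip (allSubs ts))) (map subsSize takes) ⟩
    sum (map subsSize (map skip (allSubs ts))) + sum (map subsSize takes)
      ≡⟨ cong₂ _+_ (cong sum (sym (map-∘ (allSubs ts))))
                   (sum-concatMap-map take subSize subsSize subsSize (λ _ _ → refl) (allSub t) (allSubs ts)) ⟩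
    sum (map subsSize (allSubs ts))
      + (sum (map subSize (allSub t)) * length (allSubs ts) + length (allSub t) * sum (map subsSize (allSubs ts)))
      ≡⟨ cong₂ _+_ (sum-sizes-allSubs ts)
                   (cong₂ _+_ (cong₂ _*_ (sum-sizes-allSub t) (length-allSubs ts))
                              (cong₂ _*_ (length-allSub t) (sum-sizes-allSubs ts))) ⟩
    totalSizes ts + (totalSize t * #Subs ts + #Sub t * totalSizes ts) ∎
    where
    open ≡-Reasoning
    takes : List (Subs (t ∷ ts))
    takes = concatMap (λ s → map (take s) (allSubs ts)) (allSub t)

mutual
  #Sub-pos : ∀ t → 1 ℕ.≤ #Sub t
  #Sub-pos (node ts) = #Subs-pos ts

  #Subs-pos : ∀ ts → 1 ℕ.≤ #Subs ts
  #Subs-pos []       = s≤s z≤n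
  #Subs-pos (t ∷ ts) = ℕ.*-mono-≤ (s≤s (z≤n {#Sub t})) (#Subs-pos ts)

#Subs≡product : ∀ ts → #Subs ts ≡ product (map (suc ∘ #Sub) ts)
#Subs≡product []       = refl
#Subs≡product (t ∷ ts) = cong (suc (#Sub t) *_) (#Subs≡product ts)

sum≤#Subs : ∀ ts → sum (map (suc ∘ #Sub) ts) ℕ.≤ #Subs ts
sum≤#Subs ts = ℕ.≤-trans (sum≤product (suc ∘ #Sub) (λ t → s≤s (#Sub-pos t)) ts)
                         (ℕ.≤-reflexive (sym (#Subs≡product ts)))

#Sub-nonZero : ∀ t → NonZero (#Sub t)
#Sub-nonZero t = ℕ.>-nonZero (#Sub-pos t)

λroot≡totalSize/#Sub : ∀ t .{{_ : NonZero (#Sub t)}} → λroot t ≡ (+ totalSize t) / #Sub t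
λroot≡totalSize/#Sub t = begin
  average (map subSize (allSub t))
    ≡⟨ average≡sum/length (map subSize (allSub t)) (trans (length-map subSize (allSub t)) (length-allSub t)) ⟩
  (+ sum (map subSize (allSub t))) / #Sub t
    ≡⟨ cong (λ s → (+ s) / #Sub t) (sum-sizes-allSub t) ⟩
  (+ totalSize t) / #Sub t ∎
  where open ≡-Reasoning

mutual
  nonLeavesNR : Tree → ℕ
  nonLeavesNR (node [])       = 0
  nonLeavesNR (node (t ∷ ts)) = suc (nonLeavesL (t ∷ ts))

  nonLeavesL : List Tree → ℕ
  nonLeavesL []       = 0
  nonLeavesL (t ∷ ts) = nonLeavesNR t + nonLeavesL ts

mutual
  order≡nonLeavesNR+leavesNR : ∀ t → order t ≡ nonLeavesNR t + leavesNR t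
  order≡nonLeavesNR+leavesNR (node [])       = refl
  order≡nonLeavesNR+leavesNR (node (t ∷ ts)) = cong suc (orderL≡nonLeavesL+leavesL (t ∷ ts))

  orderL≡nonLeavesL+leavesL : ∀ ts → orderL ts ≡ nonLeavesL ts + leavesL ts
  orderL≡nonLeavesL+leavesL []       = refl
  orderL≡nonLeavesL+leavesL (t ∷ ts) = begin
    order t + orderL ts
      ≡⟨ cong₂ _+_ (order≡nonLeavesNR+leavesNR t) (orderL≡nonLeavesL+leavesL ts) ⟩
    (nonLeavesNR t + leavesNR t) + (nonLeavesL ts + leavesL ts)
      ≡⟨ interchange (nonLeavesNR t) (leavesNR t) (nonLeavesL ts) (leavesL ts) ⟩
    (nonLeavesNR t + nonLeavesL ts) + (leavesNR t + leavesL ts) ∎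
    where
    open ≡-Reasoning
    interchange : ∀ a b c d → (a + b) + (c + d) ≡ (a + c) + (b + d)
    interchange = solve-∀

nonLeaves-node : ∀ ts → nonLeaves (node ts) ≡ suc (nonLeavesL ts)
nonLeaves-node ts = begin
  suc (orderL ts) ∸ leavesL ts                     ≡⟨ cong (λ n → suc n ∸ leavesL ts) (orderL≡nonLeavesL+leavesL ts) ⟩
  suc (nonLeavesL ts + leavesL ts) ∸ leavesL ts    ≡⟨ ℕ.m+n∸n≡m (suc (nonLeavesL ts)) (leavesL ts) ⟩
  suc (nonLeavesL ts)                              ∎
  where open ≡-Reasoning

weight : Tree → ℕ
weight t = 5 * order t + nonLeavesNR t

weightL : List Tree → ℕ
weightL ts = 5 * orderL ts + nonLeavesL ts

weightL-∷ : ∀ t ts → weightL (t ∷ ts) ≡ weight t + weightL ts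
weightL-∷ t ts = distribute (order t) (orderL ts) (nonLeavesNR t) (nonLeavesL ts)
  where
  distribute : ∀ a b c d → 5 * (a + b) + (c + d) ≡ (5 * a + c) + (5 * b + d)
  distribute = solve-∀

weight-node : ∀ t ts → weight (node (t ∷ ts)) ≡ 6 + weightL (t ∷ ts)
weight-node t ts = shift (orderL (t ∷ ts)) (nonLeavesL (t ∷ ts))
  where
  shift : ∀ o k → 5 * suc o + suc k ≡ 6 + (5 * o + k)
  shift = solve-∀

mutual
  weight≤ : ∀ {t} → GoodNR t → weight t ℕ.≤ 4 * #Sub t + 1
  weight≤ (good {[]} _ _)         = ℕ.≤-refl
  weight≤ (good {_ ∷ _} deg≥3 gs) = ℕ.m≤n⇒m≤n+o 1 (weight≤-branching (good deg≥3 gs))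

  weight≤-branching : ∀ {t ts} → GoodNR (node (t ∷ ts)) → weight (node (t ∷ ts)) ℕ.≤ 4 * #Subs (t ∷ ts)
  weight≤-branching {ts = []} (good deg≥3 _) with deg≥3 (s≤s (s≤s z≤n))
  ... | s≤s (s≤s ())
  weight≤-branching {t} {ts@(_ ∷ us)} (good _ gs) = begin
    weight (node (t ∷ ts))                          ≡⟨ weight-node t ts ⟩
    6 + weightL (t ∷ ts)                            ≤⟨ ℕ.+-monoˡ-≤ _ (ℕ.*-monoʳ-≤ 3 (s≤s (s≤s (z≤n {length us})))) ⟩
    3 * length (t ∷ ts) + weightL (t ∷ ts)          ≤⟨ weightL≤ gs ⟩
    4 * sum (map (suc ∘ #Sub) (t ∷ ts))             ≤⟨ ℕ.*-monoʳ-≤ 4 (sum≤#Subs (t ∷ ts)) ⟩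
    4 * #Subs (t ∷ ts)                              ∎
    where open ℕ.≤-Reasoning

  weightL≤ : ∀ {ts} → GoodL ts → 3 * length ts + weightL ts ℕ.≤ 4 * sum (map (suc ∘ #Sub) ts)
  weightL≤ []              = z≤n
  weightL≤ {t ∷ ts} (g ∷ gs) = begin
    3 * suc (length ts) + weightL (t ∷ ts)
      ≡⟨ cong (λ w → 3 * suc (length ts) + w) (weightL-∷ t ts) ⟩
    3 * suc (length ts) + (weight t + weightL ts)
      ≡⟨ regroup (length ts) (weight t) (weightL ts) ⟩
    (3 + weight t) + (3 * length ts + weightL ts)
      ≤⟨ ℕ.+-mono-≤ (ℕ.+-monoʳ-≤ 3 (weight≤ g)) (weightL≤ gs) ⟩
    (3 + (4 * #Sub t + 1)) + 4 * sum (map (suc ∘ #Sub) ts)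
      ≡⟨ factor (#Sub t) (sum (map (suc ∘ #Sub) ts)) ⟩
    4 * sum (map (suc ∘ #Sub) (t ∷ ts)) ∎
    where
    open ℕ.≤-Reasoning
    regroup : ∀ l w W → 3 * suc l + (w + W) ≡ (3 + w) + (3 * l + W)
    regroup = solve-∀
    factor : ∀ n s → (3 + (4 * n + 1)) + 4 * s ≡ 4 * (suc n + s)
    factor = solve-∀

mutual
  weight-average : ∀ {t} → GoodNR t → weight t * suc (#Sub t) ℕ.≤ 10 * totalSize t
  weight-average (good {[]} _ _) = ℕ.≤-refl
  weight-average (good {u ∷ us} deg≥3 gs) = begin
    w * suc P                  ≡⟨ ℕ.*-suc w P ⟩
    w + w * P                  ≡⟨ cong (λ x → w + x * P) (weight-node u us) ⟩
    w + (6 + W) * P            ≡⟨ regroup w W P ⟩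
    (w + 6 * P) + W * P        ≤⟨ ℕ.+-mono-≤ (ℕ.+-monoˡ-≤ (6 * P) (weight≤-branching (good deg≥3 gs)))
                                             (weightL-average gs) ⟩
    (4 * P + 6 * P) + 10 * T   ≡⟨ collect P T ⟩
    10 * (P + T)               ∎
    where
    open ℕ.≤-Reasoning
    w W P T : ℕ
    w = weight (node (u ∷ us))
    W = weightL (u ∷ us)
    P = #Subs (u ∷ us)
    T = totalSizes (u ∷ us)
    regroup : ∀ w W P → w + (6 + W) * P ≡ (w + 6 * P) + W * P
    regroup = solve-∀
    collect : ∀ P T → (4 * P + 6 * P) + 10 * T ≡ 10 * (P + T)
    collect = solve-∀

  weightL-average : ∀ {ts} → GoodL ts → weightL ts * #Subs ts ℕ.≤ 10 * totalSizes ts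
  weightL-average []                = z≤n
  weightL-average {t ∷ ts} (g ∷ gs) = begin
    weightL (t ∷ ts) * (suc N * P)        ≡⟨ cong (_* (suc N * P)) (weightL-∷ t ts) ⟩
    (w + W) * (suc N * P)                 ≡⟨ regroup w W N P ⟩
    (w * suc N) * P + (W * P) * suc N     ≤⟨ ℕ.+-mono-≤ (ℕ.*-monoˡ-≤ P (weight-average g))
                                                        (ℕ.*-monoˡ-≤ (suc N) (weightL-average gs)) ⟩
    (10 * S) * P + (10 * T) * suc N       ≡⟨ collect S P T N ⟩
    10 * (T + (S * P + N * T))            ∎
    where
    open ℕ.≤-Reasoning
    w W N P S T : ℕ
    w = weight t
    W = weightL ts
    N = #Sub t
    P = #Subs ts
    S = totalSize t
    T = totalSizes ts
    regroup : ∀ w W N P → (w + W) * (suc N * P) ≡ (w * suc N) * P + (W * P) * suc N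
    regroup = solve-∀
    collect : ∀ S P T N → (10 * S) * P + (10 * T) * suc N ≡ 10 * (T + (S * P + N * T))
    collect = solve-∀

root-average : ∀ {ts} → GoodL ts → (10 + weightL ts) * #Subs ts ℕ.≤ totalSize (node ts) * 10
root-average {ts} gs = begin
  (10 + weightL ts) * #Subs ts                ≡⟨ ℕ.*-distribʳ-+ (#Subs ts) 10 (weightL ts) ⟩
  10 * #Subs ts + weightL ts * #Subs ts       ≤⟨ ℕ.+-monoʳ-≤ (10 * #Subs ts) (weightL-average gs) ⟩
  10 * #Subs ts + 10 * totalSizes ts          ≡⟨ sym (ℕ.*-distribˡ-+ 10 (#Subs ts) (totalSizes ts)) ⟩
  10 * (#Subs ts + totalSizes ts)             ≡⟨ ℕ.*-comm 10 (#Subs ts + totalSizes ts) ⟩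
  (#Subs ts + totalSizes ts) * 10             ∎
  where open ℕ.≤-Reasoning

-- The bound needs no condition on the degree of the root.
children-good : ∀ {ts} → InT3 (node ts) → GoodL ts
children-good single        = []
children-good (rooted _ gs) = gs

lemma10 : (T : Tree) → InT3 T →
    ((+ (order T + 1)) / 2) +ℚ (((+ nonLeaves T) - (+ 1)) / 10) ≤ λroot T
lemma10 (node ts) T∈T₃ = begin
  (+ (order T + 1)) / 2 +ℚ ((+ nonLeaves T) - + 1) / 10
    ≡⟨ cong (λ k → (+ (order T + 1)) / 2 +ℚ ((+ k) - + 1) / 10) (nonLeaves-node ts) ⟩
  (+ (order T + 1)) / 2 +ℚ ((+ suc (nonLeavesL ts)) - + 1) / 10
    ≡⟨⟩
  (+ (order T + 1)) / 2 +ℚ (+ nonLeavesL ts) / 10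
    ≡⟨ half+tenth (order T + 1) (nonLeavesL ts) ⟩
  (+ (5 * (order T + 1) + nonLeavesL ts)) / 10
    ≡⟨ cong (λ n → (+ n) / 10) (regroup (orderL ts) (nonLeavesL ts)) ⟩
  (+ (10 + weightL ts)) / 10
    ≤⟨ /-≤-cross (10 + weightL ts) 10 (totalSize T) (#Sub T) (root-average (children-good T∈T₃)) ⟩
  (+ totalSize T) / #Sub T
    ≡⟨ sym (λroot≡totalSize/#Sub T) ⟩
  λroot T ∎
  where
  open ℚ.≤-Reasoning
  T : Tree
  T = node ts
  instance
    #SubT-nonZero : NonZero (#Sub T)
    #SubT-nonZero = #Sub-nonZero T
  regroup : ∀ o k → 5 * (suc o + 1) + k ≡ 10 + (5 * o + k)
  regroup = solve-∀
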